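{- If $\mathfrak{M}$ is an $\mathsf{IFOM}$-structure, then $\mathfrak{M}^{\bullet}$ is a Cartesian intuitionistic neighbourhood model.
   Context: $\mathsf{IFOM}$-structures: $\mathfrak{M}=(W,\le,\mathcal{I})$ with $(W,\le)$ a poset and, for each $w$, sets $\mathcal{I}(\mathsf{s},w),\mathcal{I}(\mathsf{n},w)$, relations $\mathcal{I}(\mathsf{N},w)\subseteq\mathcal{I}(\mathsf{s},w)\times\mathcal{I}(\mathsf{n},w)$, $\mathcal{I}(\mathsf{E},w)\subseteq\mathcal{I}(\mathsf{n},w)\times\mathcal{I}(\mathsf{s},w)$, $\mathcal{I}(P_i,w)\subseteq\mathcal{I}(\mathsf{s},w)$, with $w\le w'$ implying $\mathcal{I}(X,w)\subseteq\mathcal{I}(X,w')$ for all these $X$. Intuitionistic neighbourhood model: $(W,\le,N,V)$ with $(W,\le)$ a poset, $N$ a set of partial functions $a:W\rightharpoonup\mathcal{P}(W)$ whose domains are upsets, $V$ mapping proposition letters to upsets. The model $\mathfrak{M}^{\bullet}=(W^{\bullet},\leqq,N^{\bullet},V^{\bullet})$: $W^{\bullet}=\{\langle w,x\rangle\mid w\in W,x\in\mathcal{I}(\mathsf{s},w)\}$; $\langle w,x\rangle\leqq\langle w',x'\rangle$ iff $w\le w'$ and $x=x'$; for $a\in\bigcup_w\mathcal{I}(\mathsf{n},w)$, $a^{\bullet}(\langle w,x\rangle)=\{\langle w,y\rangle\in W^{\bullet}\mid(a,y)\in\mathcal{I}(\mathsf{E},w)\}$ if $a\in\mathcal{I}(\mathsf{n},w)$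 and $(x,a)\in\mathcal{I}(\mathsf{N},w)$, undefined otherwise; $N^{\bullet}=\{a^{\bullet}\mid a\in\mathcal{I}(\mathsf{n},w)\text{ for some }w\}$; $V^{\bullet}(p_i)=\{\langle w,x\rangle\mid x\in\mathcal{I}(P_i,w)\}$. Cartesian: in a model $(W,\le,N,V)$ define $wRv$ iff $v\in a(w)$ for some $a\in N$; $R^{\sim}$ is the equivalence closure of $R$, $\le^{\sim}$ the equivalence closure of $\le$. The model is $R^{\sim}$-Cartesian if $w\le^{\sim}v\,R^{\sim}\,w$ implies $w=v$; N-Cartesian if $wR^{\sim}v$ and $w,v\in\mathrm{dom}(a)$ imply $a(w)=a(v)$ for all $a\in N$; Cartesian if both. -}

module Defs where

open import Data.Nat using (ℕ)
open import Data.Product using (Σ; ∃; _×_; _,_; proj₁)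
open import Relation.Binary.PropositionalEquality using (_≡_)
open import Relation.Binary.Structures using (IsPartialOrder)
open import Relation.Binary.Construct.Closure.Equivalence using (EqClosure)
open import Function.Bundles using (_⇔_)

-- IFOM-structures  M = (W, ≤, I)
-- The (varying) domains I(s,w), I(n,w) are subsets of fixed carriers
-- Ds, Dn (needed to express the inclusions I(X,w) ⊆ I(X,w')).

record IFOM : Set₁ where
  field
    W    : Set
    _≤_  : W → W → Set
    isPO : IsPartialOrder _≡_ _≤_
    Ds Dn : Set
    Is : W → Ds → Set
    In : W → Dn → Set
    IN : W → Ds → Dn → Set
    IE : W → Dn → Ds → Set
    IP : ℕ → W → Ds → Set
    IN-sub : ∀ {w x a} → IN w x a → Is w x × In w a
    IE-sub : ∀ {w a y} → IE w a y → In w a × Is w y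
    IP-sub : ∀ {i w x} → IP i w x → Is w x
    Is-mono : ∀ {w w'} → w ≤ w' → ∀ {x} → Is w x → Is w' x
    In-mono : ∀ {w w'} → w ≤ w' → ∀ {a} → In w a → In w' a
    IN-mono : ∀ {w w'} → w ≤ w' → ∀ {x a} → IN w x a → IN w' x a
    IE-mono : ∀ {w w'} → w ≤ w' → ∀ {a y} → IE w a y → IE w' a y
    IP-mono : ∀ {i w w'} → w ≤ w' → ∀ {x} → IP i w x → IP i w' x

-- N is given as a family of partial functions indexed by A:
--   dom a w     : w ∈ dom(a)
--   app a w v   : v ∈ a(w)   (only meaningful when dom a w)
-- V i : upset interpreting proposition letter p_i.

record NbhdData : Set₁ where
  field
    W   : Set
    _≤_ : W → W → Set
    A   : Set
    dom : A → W → Set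
    app : A → W → W → Set
    V   : ℕ → W → Set

record IsNbhdModel (M : NbhdData) : Set where
  open NbhdData M
  field
    isPO   : IsPartialOrder _≡_ _≤_
    dom-up : ∀ a {w w'} → w ≤ w' → dom a w → dom a w'
    V-up   : ∀ i {w w'} → w ≤ w' → V i w → V i w'

module _ (M : NbhdData) where
  open NbhdData M

  Rel-R : W → W → Set
  Rel-R w v = Σ A (λ a → dom a w × app a w v)

  R∼ : W → W → Set
  R∼ = EqClosure Rel-R

  ≤∼ : W → W → Set
  ≤∼ = EqClosure _≤_

  R∼-Cartesian : Set
  R∼-Cartesian = ∀ {w v} → ≤∼ w v → R∼ v w → w ≡ v

  N-Cartesian : Set
  N-Cartesian = ∀ {w v} → R∼ w v → ∀ a → dom a w → dom a v →
                ∀ u → (app a w u ⇔ app a v u)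

  Cartesian : Set
  Cartesian = R∼-Cartesian × N-Cartesian

module _ (M : IFOM) where
  open IFOM M

  -- points ⟨w,x⟩ with x ∈ I(s,w); membership proof is irrelevant, so
  -- equality of points is equality of the pair (w,x).
  record Pt : Set where
    constructor ⟨_,_⟩[_]
    field
      wd : W
      xd : Ds
      .inS : Is wd xd
  open Pt public

  _≦_ : Pt → Pt → Set
  p ≦ q = (wd p ≤ wd q) × (xd p ≡ xd q)

  A• : Set
  A• = Σ Dn (λ a → ∃ (λ w → In w a))

  dom• : A• → Pt → Set
  dom• (a , _) p = In (wd p) a × IN (wd p) (xd p) a

  app• : A• → Pt → Pt → Set
  app• (a , _) p q = (wd q ≡ wd p) × IE (wd p) a (xd q)

  V• : ℕ → Pt → Set
  V• i p = IP i (wd p) (xd p)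

  bullet : NbhdData
  bullet = record
    { W = Pt ; _≤_ = _≦_ ; A = A• ; dom = dom• ; app = app• ; V = V• }

{-# OPTIONS --safe #-}
module Submission where

-- A point ⟨w,x⟩ of M• moves along ≤ only in its world and along R only in its
-- element, since a•(⟨w,x⟩) stays inside world w. Hence ≤∼ preserves the element
-- and R∼ the world, so a point that is both ≤∼- and R∼-related to another is
-- equal to it; and as a•(⟨w,x⟩) depends on w alone, it is constant on R∼-classes.

open import Defs
open import Data.Product using (_×_; _,_; proj₂)
open import Function.Bundles using (_⇔_)
open import Function.Construct.Identity using (⇔-id)
open import Relation.Binary.Construct.Closure.Equivalence using (gfold)
open import Relation.Binary.PropositionalEquality
  using (_≡_; refl; sym; trans; isEquivalence)
open import Relation.Binary.Structures using (IsPartialOrder)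

module _ (M : IFOM) where
  open IFOM M
  private module ≤ = IsPartialOrder isPO

  Pt-≡ : {p q : Pt M} → wd p ≡ wd q → xd p ≡ xd q → p ≡ q
  Pt-≡ {⟨ _ , _ ⟩[ _ ]} {⟨ _ , _ ⟩[ _ ]} refl refl = refl

  ≦-isPartialOrder : IsPartialOrder _≡_ (_≦_ M)
  ≦-isPartialOrder = record
    { isPreorder = record
      { isEquivalence = isEquivalence
      ; reflexive     = λ { refl → ≤.refl , refl }
      ; trans         = λ { (w≤w′ , x≡x′) (w′≤w″ , x′≡x″) →
                              ≤.trans w≤w′ w′≤w″ , trans x≡x′ x′≡x″ }
      }
    ; antisym = λ { (w≤w′ , x≡x′) (w′≤w , _) → Pt-≡ (≤.antisym w≤w′ w′≤w) x≡x′ }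
    }

  dom•-up : ∀ a {p q} → _≦_ M p q → dom• M a p → dom• M a q
  dom•-up (a , _) {⟨ _ , _ ⟩[ _ ]} {⟨ _ , _ ⟩[ _ ]} (w≤w′ , refl) (a∈n , xa∈N) =
    In-mono w≤w′ a∈n , IN-mono w≤w′ xa∈N

  V•-up : ∀ i {p q} → _≦_ M p q → V• M i p → V• M i q
  V•-up i {⟨ _ , _ ⟩[ _ ]} {⟨ _ , _ ⟩[ _ ]} (w≤w′ , refl) = IP-mono w≤w′

  bullet-isNbhdModel : IsNbhdModel (bullet M)
  bullet-isNbhdModel = record
    { isPO   = ≦-isPartialOrder
    ; dom-up = dom•-up
    ; V-up   = V•-up
    }

  ≤∼⇒≡-xd : ∀ {p q} → ≤∼ (bullet M) p q → xd p ≡ xd q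
  ≤∼⇒≡-xd = gfold isEquivalence xd proj₂

  R∼⇒≡-wd : ∀ {p q} → R∼ (bullet M) p q → wd p ≡ wd q
  R∼⇒≡-wd = gfold isEquivalence wd λ { (_ , _ , wq≡wp , _) → sym wq≡wp }

  bullet-R∼-Cartesian : R∼-Cartesian (bullet M)
  bullet-R∼-Cartesian p≤∼q qR∼p = Pt-≡ (sym (R∼⇒≡-wd qR∼p)) (≤∼⇒≡-xd p≤∼q)

  app•-cong-wd : ∀ a {p q} → wd p ≡ wd q → ∀ u → app• M a p u ⇔ app• M a q u
  app•-cong-wd a wp≡wq u rewrite wp≡wq = ⇔-id _

  bullet-N-Cartesian : N-Cartesian (bullet M)
  bullet-N-Cartesian {p} {q} pR∼q a _ _ = app•-cong-wd a {p} {q} (R∼⇒≡-wd pR∼q)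

lemma3p18 : (M : IFOM) → IsNbhdModel (bullet M) × Cartesian (bullet M)
lemma3p18 M = bullet-isNbhdModel M , bullet-R∼-Cartesian M , bullet-N-Cartesian M
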